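{- Let $n\ge1$ and let $B$ be an antichain of $\Phi^+(A_{2n-1})$ with $\eta(B)=B$. Then exactly one of $B$ and $\operatorname{Rvac}(B)$ contains an element of $\mathcal{S}_{A_{2n-1}}=\{[i,j]\in\Phi^+(A_{2n-1}):i=n\text{ or }j=n+1\}$.
   Context: $\Phi^+(A_{2n-1})$ is the poset of intervals $[i,j]=\{i,\ldots,j\}$ with $1\le i<j\le 2n$, ordered by containment, ranked by $\mathrm{rk}([i,j])=j-i-1$. $\eta$ is the poset automorphism $\eta([i,j])=[2n+1-j,2n+1-i]$. For a finite ranked poset with rank sets $P_i$, the toggle $\tau_p$ on antichains removes $p$ if present, adds $p$ if the result is an antichain, and otherwise does nothing; $\boldsymbol{\tau}_i$ is the composite of $\tau_p$ over $p\in P_i$; with $R$ the maximal rank and composition right to left, rowvacuation is $\operatorname{Rvac}=(\boldsymbol{\tau}_R)(\boldsymbol{\tau}_R\boldsymbol{\tau}_{R-1})\cdots(\boldsymbol{\tau}_R\cdots\boldsymbol{\tau}_0)$. -}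

module Defs where

open import Data.Bool using (Bool; true; false; _∧_; _∨_; not; if_then_else_)
open import Data.Nat using (ℕ; zero; suc; _+_; _*_; _∸_; _≤_; _<_; _≡ᵇ_; _≤ᵇ_; _<ᵇ_)
open import Data.List using (List; map; foldl; upTo)
open import Data.Bool.ListAction using (any)
open import Data.Product using (_×_; Σ; ∃)
open import Data.Sum using (_⊎_)
open import Relation.Binary.PropositionalEquality using (_≡_)

-- A subset of intervals: characteristic function, (i , j) ↦ [i,j] ∈ A.
Sub : Set
Sub = ℕ → ℕ → Bool

-- [i,j] ∈ Φ⁺(A_{2n-1})  iff  1 ≤ i < j ≤ 2n
Valid : ℕ → ℕ → ℕ → Set
Valid n i j = (1 ≤ i) × (i < j) × (j ≤ 2 * n)

validᵇ : ℕ → ℕ → ℕ → Bool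
validᵇ n i j = (1 ≤ᵇ i) ∧ (i <ᵇ j) ∧ (j ≤ᵇ 2 * n)

-- [i,j] ⊆ [k,l]  (the order of the poset is containment)
leᵇ : ℕ → ℕ → ℕ → ℕ → Bool
leᵇ i j k l = (k ≤ᵇ i) ∧ (j ≤ᵇ l)

IsAntichain : ℕ → Sub → Set
IsAntichain n A =
  (∀ i j → A i j ≡ true → Valid n i j) ×
  (∀ i j k l → A i j ≡ true → A k l ≡ true → k ≤ i → j ≤ l → (i ≡ k) × (j ≡ l))

EtaInvariant : ℕ → Sub → Set
EtaInvariant n B = ∀ i j → Valid n i j → B i j ≡ B (2 * n + 1 ∸ j) (2 * n + 1 ∸ i)

update : Sub → ℕ → ℕ → Bool → Sub
update A i j b k l = if (k ≡ᵇ i) ∧ (l ≡ᵇ j) then b else A k l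

-- candidate coordinates 0 .. 2n (enough to cover all elements of the poset)
coords : ℕ → List ℕ
coords n = upTo (suc (2 * n))

hasComparable : ℕ → Sub → ℕ → ℕ → Bool
hasComparable n A i j =
  any (λ k → any (λ l → validᵇ n k l ∧ A k l ∧ (leᵇ i j k l ∨ leᵇ k l i j)) (coords n)) (coords n)

toggle : ℕ → ℕ → ℕ → Sub → Sub
toggle n i j A =
  if A i j then update A i j false
  else (if hasComparable n A i j then A else update A i j true)

-- elements of rank r: [i, i+r+1] with 1 ≤ i and i+r+1 ≤ 2n
rankStarts : ℕ → ℕ → List ℕ
rankStarts n r = map suc (upTo (2 * n ∸ (r + 1)))

-- 𝛕_r : composite of τ_p over p of rank r (they commute; listed order is immaterial)
rankToggle : ℕ → ℕ → Sub → Sub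
rankToggle n r A = foldl (λ B i → toggle n i (i + r + 1) B) A (rankStarts n r)

maxRank : ℕ → ℕ
maxRank n = 2 * n ∸ 2

-- 𝛕_R ⋯ 𝛕_k  (apply 𝛕_k first, then 𝛕_{k+1}, …, 𝛕_R last)
segment : ℕ → ℕ → Sub → Sub
segment n k A = foldl (λ B r → rankToggle n r B) A (map (k +_) (upTo (suc (maxRank n) ∸ k)))

-- Rvac = (𝛕_R)(𝛕_R 𝛕_{R-1}) ⋯ (𝛕_R ⋯ 𝛕_0), composed right to left:
-- first apply segment 0, then segment 1, …, finally segment R.
Rvac : ℕ → Sub → Sub
Rvac n A = foldl (λ B k → segment n k B) A (upTo (suc (maxRank n)))

MeetsS : ℕ → Sub → Set
MeetsS n A = Σ ℕ λ i → Σ ℕ λ j → Valid n i j × A i j ≡ true × ((i ≡ n) ⊎ (j ≡ suc n))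

-- Toggling an antichain S rank by rank upwards from rank h (the segment 𝛕_R ⋯ 𝛕_h) keeps S below
-- rank h and, from rank h on, produces the minimal elements of rank ≥ h that are outside the
-- down-set of S and contain no element of S of rank < h.  Feeding this into the later segments,
-- a downward induction on h shows: 𝛕_R(𝛕_R 𝛕_{R-1})⋯(𝛕_R ⋯ 𝛕_h) S contains some [x,y] with
-- y ≥ x+h+1 iff [x,x+h+1] contains no element of S of rank < h and S contains no [w,x+h+1]
-- with w ≤ x.  For h = 0 and x = n: Rvac B meets {[n,y]} iff B misses {[w,n+1]}.  These two sets
-- make up S_{A_{2n-1}} and are exchanged by η, which commutes with Rvac; so for η-invariant B,
-- B meets S iff it meets {[w,n+1]}, and Rvac B meets S iff it meets {[n,y]}.

module Submission where

open import Defs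
open import Data.Bool using (Bool; true; false; _∧_; _∨_; not; T)
open import Data.Bool.Properties using () renaming (_≟_ to _≟ᵇ_)
open import Data.Bool.ListAction using (any)
open import Data.List using ([]; _∷_; map; foldl; upTo; applyUpTo; iterate)
open import Data.List.Properties using (map-applyUpTo)
open import Data.List.Membership.Propositional using (find; lose)
open import Data.List.Membership.Propositional.Properties using (∈-upTo⁺; ∈-upTo⁻)
open import Data.List.Relation.Unary.Any.Properties using (any⁺; any⁻)
open import Data.Nat using (ℕ; zero; suc; _+_; _*_; _∸_; _≤_; _<_; z≤n; s≤s; z<s; s≤s⁻¹; _≤?_; _<?_; _≡ᵇ_; _≤ᵇ_)
open import Data.Nat.Properties
open import Data.Product using (_×_; Σ; _,_; proj₁; proj₂)
open import Data.Sum using (_⊎_; inj₁; inj₂)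
open import Data.Empty using (⊥; ⊥-elim)
open import Data.Unit using (tt)
open import Function using (_∘_; id; _⇔_; mk⇔; Equivalence)
open import Relation.Nullary using (¬_; Dec; yes; no)
open import Relation.Nullary.Decidable using (_×-dec_)
open import Relation.Binary.PropositionalEquality

≡true⇒T : ∀ {b} → b ≡ true → T b
≡true⇒T refl = tt

T⇒≡true : ∀ {b} → T b → b ≡ true
T⇒≡true {true} _ = refl

∧-true⁻ : ∀ {a b} → a ∧ b ≡ true → a ≡ true × b ≡ true
∧-true⁻ {true} {true} _ = refl , refl

∧-true⁺ : ∀ {a b} → a ≡ true → b ≡ true → a ∧ b ≡ true
∧-true⁺ refl refl = refl

∨-true⁻ : ∀ {a b} → a ∨ b ≡ true → a ≡ true ⊎ b ≡ true
∨-true⁻ {true} _ = inj₁ refl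
∨-true⁻ {false} e = inj₂ e

∨-trueˡ : ∀ {a b} → a ≡ true → a ∨ b ≡ true
∨-trueˡ refl = refl

∨-trueʳ : ∀ {a b} → b ≡ true → a ∨ b ≡ true
∨-trueʳ {true} _ = refl
∨-trueʳ {false} e = e

¬true⇒false : ∀ {b} → ¬ (b ≡ true) → b ≡ false
¬true⇒false {true} ne = ⊥-elim (ne refl)
¬true⇒false {false} _ = refl

true≢false : ∀ {b} → b ≡ true → b ≡ false → ⊥
true≢false refl ()

true-ext : ∀ {a b} → (a ≡ true → b ≡ true) → (b ≡ true → a ≡ true) → a ≡ b
true-ext {true} f g = sym (f refl)
true-ext {false} {true} f g = g refl
true-ext {false} {false} f g = refl

not∧not-true⁻ : ∀ {a b} → not a ∧ not b ≡ true → a ≡ false × b ≡ false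
not∧not-true⁻ {false} {false} _ = refl , refl

not∧not-true⁺ : ∀ {a b} → a ≡ false → b ≡ false → not a ∧ not b ≡ true
not∧not-true⁺ refl refl = refl

≤ᵇ-true⁻ : ∀ {a b} → (a ≤ᵇ b) ≡ true → a ≤ b
≤ᵇ-true⁻ {a} {b} e = ≤ᵇ⇒≤ a b (≡true⇒T e)

≤ᵇ-true⁺ : ∀ {a b} → a ≤ b → (a ≤ᵇ b) ≡ true
≤ᵇ-true⁺ a≤b = T⇒≡true (≤⇒≤ᵇ a≤b)

applyUpTo-iterate : ∀ (f : ℕ → ℕ) a m → (∀ x → f x ≡ a + x) → applyUpTo f m ≡ iterate suc a m
applyUpTo-iterate f a zero f≗a+ = refl
applyUpTo-iterate f a (suc m) f≗a+ =
  cong₂ _∷_ (trans (f≗a+ 0) (+-identityʳ a))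
            (applyUpTo-iterate (f ∘ suc) (suc a) m (λ x → trans (f≗a+ (suc x)) (+-suc a x)))

map-+-upTo : ∀ a m → map (a +_) (upTo m) ≡ iterate suc a m
map-+-upTo a m = trans (map-applyUpTo id (a +_) m) (applyUpTo-iterate (a +_) a m (λ _ → refl))

any-upTo⁻ : ∀ (p : ℕ → Bool) m → any p (upTo m) ≡ true → Σ ℕ λ x → x < m × p x ≡ true
any-upTo⁻ p m e with find (any⁻ p (upTo m) (≡true⇒T e))
... | x , x∈ , px = x , ∈-upTo⁻ x∈ , T⇒≡true px

any-upTo⁺ : ∀ (p : ℕ → Bool) {m} x → x < m → p x ≡ true → any p (upTo m) ≡ true
any-upTo⁺ p x x<m px = T⇒≡true (any⁺ p (lose (∈-upTo⁺ x<m) (≡true⇒T px)))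

foldl-preserves : ∀ {X Y : Set} (P : X → Set) (f : X → Y → X) → (∀ a y → P a → P (f a y)) →
                  ∀ ys a → P a → P (foldl f a ys)
foldl-preserves P f pres [] a p = p
foldl-preserves P f pres (y ∷ ys) a p = foldl-preserves P f pres ys (f a y) (pres a y p)

foldl-preserves₂ : ∀ {X Y : Set} (_∼_ : X → X → Set) (f : X → Y → X) →
                   (∀ a b y → a ∼ b → f a y ∼ f b y) →
                   ∀ ys a b → a ∼ b → foldl f a ys ∼ foldl f b ys
foldl-preserves₂ _∼_ f pres [] a b p = p
foldl-preserves₂ _∼_ f pres (y ∷ ys) a b p = foldl-preserves₂ _∼_ f pres ys (f a y) (f b y) (pres a b y p)

crossing : ∀ {P : ℕ → Set} → (∀ v → Dec (P v)) → ∀ {w x} → w ≤ x → ¬ P w → P (suc x) →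
           Σ ℕ λ v → w ≤ v × v ≤ x × ¬ P v × P (suc v)
crossing P? {w} {x} w≤x ¬Pw P1+x with P? x
... | no ¬Px = x , w≤x , ≤-refl , ¬Px , P1+x
crossing P? {w} {zero} z≤n ¬Pw P1+x | yes Px = ⊥-elim (¬Pw Px)
crossing P? {w} {suc x} w≤1+x ¬Pw P1+x | yes Px with m≤n⇒m<n∨m≡n w≤1+x
... | inj₂ refl = ⊥-elim (¬Pw Px)
... | inj₁ w<1+x with crossing P? (s≤s⁻¹ w<1+x) ¬Pw Px
... | v , w≤v , v≤x , ¬Pv , P1+v = v , w≤v , m≤n⇒m≤1+n v≤x , ¬Pv , P1+v

module Poset (n : ℕ) where

  Φ⁺ : ℕ → ℕ → Set
  Φ⁺ = Valid n

  In : Sub → ℕ → ℕ → Set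
  In A i j = A i j ≡ true

  Inside : ℕ → ℕ → ℕ → ℕ → Set
  Inside i j k l = k ≤ i × j ≤ l

  Comparable : ℕ → ℕ → ℕ → ℕ → Set
  Comparable i j k l = Inside i j k l ⊎ Inside k l i j

  HasComparable : Sub → ℕ → ℕ → Set
  HasComparable A i j = Σ ℕ λ c → Σ ℕ λ d → Φ⁺ c d × In A c d × Comparable i j c d

  Inside-refl : ∀ {i j} → Inside i j i j
  Inside-refl = ≤-refl , ≤-refl

  Inside-trans : ∀ {i j k l a b} → Inside i j k l → Inside k l a b → Inside i j a b
  Inside-trans (k≤i , j≤l) (a≤k , l≤b) = ≤-trans a≤k k≤i , ≤-trans j≤l l≤b

  validᵇ⇒Φ⁺ : ∀ {i j} → validᵇ n i j ≡ true → Φ⁺ i j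
  validᵇ⇒Φ⁺ e with ∧-true⁻ e
  ... | 1≤i , rest with ∧-true⁻ rest
  ... | i<j , j≤2n = ≤ᵇ-true⁻ 1≤i , <ᵇ⇒< _ _ (≡true⇒T i<j) , ≤ᵇ-true⁻ j≤2n

  Φ⁺⇒validᵇ : ∀ {i j} → Φ⁺ i j → validᵇ n i j ≡ true
  Φ⁺⇒validᵇ (1≤i , i<j , j≤2n) = ∧-true⁺ (≤ᵇ-true⁺ 1≤i) (∧-true⁺ (T⇒≡true (<⇒<ᵇ i<j)) (≤ᵇ-true⁺ j≤2n))

  comparableᵇ⇒Comparable : ∀ {i j k l} → (leᵇ i j k l ∨ leᵇ k l i j) ≡ true → Comparable i j k l
  comparableᵇ⇒Comparable {i} {j} {k} {l} e with ∨-true⁻ {leᵇ i j k l} e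
  ... | inj₁ le = let k≤i , j≤l = ∧-true⁻ le in inj₁ (≤ᵇ-true⁻ k≤i , ≤ᵇ-true⁻ j≤l)
  ... | inj₂ le = let i≤k , l≤j = ∧-true⁻ le in inj₂ (≤ᵇ-true⁻ i≤k , ≤ᵇ-true⁻ l≤j)

  Comparable⇒comparableᵇ : ∀ {i j k l} → Comparable i j k l → (leᵇ i j k l ∨ leᵇ k l i j) ≡ true
  Comparable⇒comparableᵇ (inj₁ (k≤i , j≤l)) = ∨-trueˡ (∧-true⁺ (≤ᵇ-true⁺ k≤i) (≤ᵇ-true⁺ j≤l))
  Comparable⇒comparableᵇ {i} {j} {k} {l} (inj₂ (i≤k , l≤j)) =
    ∨-trueʳ {leᵇ i j k l} (∧-true⁺ (≤ᵇ-true⁺ i≤k) (≤ᵇ-true⁺ l≤j))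

  Φ⁺-rightCover : ∀ {i j} → Φ⁺ i j → suc i < j → Φ⁺ (suc i) j
  Φ⁺-rightCover (_ , _ , j≤2n) 1+i<j = s≤s z≤n , 1+i<j , j≤2n

  Φ⁺-leftCover : ∀ {i j} → Φ⁺ i (suc j) → i < j → Φ⁺ i j
  Φ⁺-leftCover (1≤i , _ , 1+j≤2n) i<j = 1≤i , i<j , ≤-trans (n≤1+n _) 1+j≤2n

  Φ⁺-bounded : ∀ {c d} → Φ⁺ c d → c ≤ 2 * n × d ≤ 2 * n
  Φ⁺-bounded (_ , c<d , d≤2n) = ≤-trans (<⇒≤ c<d) d≤2n , d≤2n

  hasComparable⇒HasComparable : ∀ A i j → hasComparable n A i j ≡ true → HasComparable A i j
  hasComparable⇒HasComparable A i j e with any-upTo⁻ _ (suc (2 * n)) e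
  ... | c , _ , e′ with any-upTo⁻ _ (suc (2 * n)) e′
  ... | d , _ , e″ with ∧-true⁻ e″
  ... | valid , rest with ∧-true⁻ rest
  ... | c,d∈A , cmp = c , d , validᵇ⇒Φ⁺ valid , c,d∈A , comparableᵇ⇒Comparable cmp

  HasComparable⇒hasComparable : ∀ A i j → HasComparable A i j → hasComparable n A i j ≡ true
  HasComparable⇒hasComparable A i j (c , d , valid , c,d∈A , cmp) =
    any-upTo⁺ _ c (s≤s (proj₁ (Φ⁺-bounded valid)))
      (any-upTo⁺ _ d (s≤s (proj₂ (Φ⁺-bounded valid)))
        (∧-true⁺ (Φ⁺⇒validᵇ valid) (∧-true⁺ c,d∈A (Comparable⇒comparableᵇ cmp))))

  ¬HasComparable⇒hasComparable≡false : ∀ A i j → ¬ HasComparable A i j → hasComparable n A i j ≡ false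
  ¬HasComparable⇒hasComparable≡false A i j ¬hc = ¬true⇒false (¬hc ∘ hasComparable⇒HasComparable A i j)

  hasComparable-cong : ∀ A A′ i j → (∀ c d → Φ⁺ c d → Comparable i j c d → A c d ≡ A′ c d) →
                       hasComparable n A i j ≡ hasComparable n A′ i j
  hasComparable-cong A A′ i j agree = true-ext (transport A A′ agree) (transport A′ A (λ c d v cmp → sym (agree c d v cmp)))
    where
    transport : ∀ A A′ → (∀ c d → Φ⁺ c d → Comparable i j c d → A c d ≡ A′ c d) →
                hasComparable n A i j ≡ true → hasComparable n A′ i j ≡ true
    transport A A′ agree e with hasComparable⇒HasComparable A i j e
    ... | c , d , valid , c,d∈A , cmp =
      HasComparable⇒hasComparable A′ i j (c , d , valid , trans (sym (agree c d valid cmp)) c,d∈A , cmp)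

  update-here : ∀ A i j b → update A i j b i j ≡ b
  update-here A i j b rewrite T⇒≡true (≡⇒≡ᵇ i i refl) | T⇒≡true (≡⇒≡ᵇ j j refl) = refl

  update-elsewhere : ∀ A i j b k l → (k ≡ i → l ≡ j → ⊥) → update A i j b k l ≡ A k l
  update-elsewhere A i j b k l ≢ with k ≡ᵇ i in k≡i | l ≡ᵇ j in l≡j
  ... | true | true = ⊥-elim (≢ (≡ᵇ⇒≡ k i (≡true⇒T k≡i)) (≡ᵇ⇒≡ l j (≡true⇒T l≡j)))
  ... | true | false = refl
  ... | false | _ = refl

  toggle-here : ∀ A i j → toggle n i j A i j ≡ not (A i j) ∧ not (hasComparable n A i j)
  toggle-here A i j with A i j in i,j∉A | hasComparable n A i j
  ... | true | _ = update-here A i j false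
  ... | false | true = i,j∉A
  ... | false | false = update-here A i j true

  toggle-elsewhere : ∀ A i j k l → (k ≡ i → l ≡ j → ⊥) → toggle n i j A k l ≡ A k l
  toggle-elsewhere A i j k l ≢ with A i j | hasComparable n A i j
  ... | true | _ = update-elsewhere A i j false k l ≢
  ... | false | true = refl
  ... | false | false = update-elsewhere A i j true k l ≢

  toggleAt : ℕ → Sub → ℕ → Sub
  toggleAt r B i = toggle n i (i + r + 1) B

  comparable-sameRank⇒≡ : ∀ {a k r} → Comparable k (k + r + 1) a (a + r + 1) → a ≡ k
  comparable-sameRank⇒≡ {a} {k} {r} (inj₁ (a≤k , k+r+1≤a+r+1)) =
    ≤-antisym a≤k (+-cancelʳ-≤ r k a (+-cancelʳ-≤ 1 (k + r) (a + r) k+r+1≤a+r+1))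
  comparable-sameRank⇒≡ {a} {k} {r} (inj₂ (k≤a , a+r+1≤k+r+1)) =
    ≤-antisym (+-cancelʳ-≤ r a k (+-cancelʳ-≤ 1 (a + r) (k + r) a+r+1≤k+r+1)) k≤a

  toggleAts-elsewhere : ∀ r c a A k l → (a ≤ k → k < a + c → l ≡ k + r + 1 → ⊥) →
                        foldl (toggleAt r) A (iterate suc a c) k l ≡ A k l
  toggleAts-elsewhere r zero a A k l _ = refl
  toggleAts-elsewhere r (suc c) a A k l ≢ =
    trans (toggleAts-elsewhere r c (suc a) (toggleAt r A a) k l
             (λ a<k k<a+1+c → ≢ (<⇒≤ a<k) (subst (k <_) (sym (+-suc a c)) k<a+1+c)))
          (toggle-elsewhere A a (a + r + 1) k l (λ { refl l≡ → ≢ ≤-refl (m<m+n k z<s) l≡ }))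

  toggleAts-here : ∀ r c a A k → a ≤ k → k < a + c →
                   foldl (toggleAt r) A (iterate suc a c) k (k + r + 1)
                     ≡ not (A k (k + r + 1)) ∧ not (hasComparable n A k (k + r + 1))
  toggleAts-here r zero a A k a≤k k<a+0 = ⊥-elim (<-irrefl refl (≤-<-trans a≤k (subst (k <_) (+-identityʳ a) k<a+0)))
  toggleAts-here r (suc c) a A k a≤k k<a+1+c with m≤n⇒m<n∨m≡n a≤k
  ... | inj₂ refl =
    trans (toggleAts-elsewhere r c (suc a) (toggleAt r A a) a (a + r + 1) (λ a<a _ _ → <-irrefl refl a<a))
          (toggle-here A a (a + r + 1))
  ... | inj₁ a<k =
    trans (toggleAts-here r c (suc a) (toggleAt r A a) k a<k (subst (k <_) (+-suc a c) k<a+1+c))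
          (cong₂ (λ x y → not x ∧ not y)
            (toggle-elsewhere A a (a + r + 1) k (k + r + 1) (λ { refl _ → <-irrefl refl a<k }))
            (hasComparable-cong (toggleAt r A a) A k (k + r + 1)
              (λ c d _ cmp → toggle-elsewhere A a (a + r + 1) c d
                 (λ { refl refl → <-irrefl (comparable-sameRank⇒≡ cmp) a<k }))))

  rankToggle-unfold : ∀ r A → rankToggle n r A ≡ foldl (toggleAt r) A (iterate suc 1 (2 * n ∸ (r + 1)))
  rankToggle-unfold r A = cong (foldl (toggleAt r) A) (map-+-upTo 1 (2 * n ∸ (r + 1)))

  rankToggle-onRank : ∀ r A k l → Φ⁺ k l → l ≡ k + r + 1 →
                      rankToggle n r A k l ≡ not (A k l) ∧ not (hasComparable n A k l)
  rankToggle-onRank r A k l (1≤k , _ , l≤2n) refl =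
    trans (cong (λ B → B k (k + r + 1)) (rankToggle-unfold r A))
          (toggleAts-here r (2 * n ∸ (r + 1)) 1 A k 1≤k
            (s≤s (m+n≤o⇒m≤o∸n k (subst (_≤ 2 * n) (+-assoc k r 1) l≤2n))))

  rankToggle-offRank : ∀ r A k l → (l ≡ k + r + 1 → Φ⁺ k l → ⊥) → rankToggle n r A k l ≡ A k l
  rankToggle-offRank r A k l ≢ =
    trans (cong (λ B → B k l) (rankToggle-unfold r A))
          (toggleAts-elsewhere r (2 * n ∸ (r + 1)) 1 A k l
            (λ 1≤k k<1+m l≡ → ≢ l≡ (1≤k , k<l l≡ , l≤2n 1≤k (s≤s⁻¹ k<1+m) l≡)))
    where
    k<l : l ≡ k + r + 1 → k < l
    k<l refl = subst (k <_) (sym (+-assoc k r 1)) (m<m+n k (m≤n+m 1 r))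
    l≤2n : 1 ≤ k → k ≤ 2 * n ∸ (r + 1) → l ≡ k + r + 1 → l ≤ 2 * n
    l≤2n 1≤k k≤ refl with r + 1 ≤? 2 * n
    ... | yes r+1≤2n = subst (_≤ 2 * n) (sym (+-assoc k r 1)) (m≤o∸n⇒m+n≤o k r+1≤2n k≤)
    ... | no r+1≰2n = ⊥-elim (<-irrefl refl (≤-trans 1≤k (subst (k ≤_) (m≤n⇒m∸n≡0 (<⇒≤ (≰⇒> r+1≰2n))) k≤)))

  Φ⁺? : ∀ i j → Dec (Φ⁺ i j)
  Φ⁺? i j = (1 ≤? i) ×-dec ((suc i ≤? j) ×-dec (j ≤? 2 * n))

  In? : ∀ A i j → Dec (In A i j)
  In? A i j = A i j ≟ᵇ true

  rankToggle-true⁻ : ∀ r A k l → In (rankToggle n r A) k l →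
                     In A k l ⊎ (Φ⁺ k l × l ≡ k + r + 1 × ¬ HasComparable A k l)
  rankToggle-true⁻ r A k l e with l ≟ k + r + 1 | Φ⁺? k l
  ... | yes l≡ | yes valid =
    let _ , no-comparable = not∧not-true⁻ (trans (sym (rankToggle-onRank r A k l valid l≡)) e)
    in inj₂ (valid , l≡ , λ hc → true≢false (HasComparable⇒hasComparable A k l hc) no-comparable)
  ... | yes _ | no invalid = inj₁ (trans (sym (rankToggle-offRank r A k l λ _ v → invalid v)) e)
  ... | no l≢ | _ = inj₁ (trans (sym (rankToggle-offRank r A k l λ l≡ _ → l≢ l≡)) e)

  rankToggle-antichain : ∀ r A → IsAntichain n A → IsAntichain n (rankToggle n r A)
  rankToggle-antichain r A (A⊆Φ⁺ , A-antichain) = valid , antichain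
    where
    valid : ∀ i j → In (rankToggle n r A) i j → Φ⁺ i j
    valid i j e with rankToggle-true⁻ r A i j e
    ... | inj₁ i,j∈A = A⊆Φ⁺ i j i,j∈A
    ... | inj₂ (v , _) = v
    antichain : ∀ i j k l → In (rankToggle n r A) i j → In (rankToggle n r A) k l →
                k ≤ i → j ≤ l → (i ≡ k) × (j ≡ l)
    antichain i j k l e e′ k≤i j≤l with rankToggle-true⁻ r A i j e | rankToggle-true⁻ r A k l e′
    ... | inj₁ i,j∈A | inj₁ k,l∈A = A-antichain i j k l i,j∈A k,l∈A k≤i j≤l
    ... | inj₂ (_ , _ , ¬hc) | inj₁ k,l∈A = ⊥-elim (¬hc (k , l , A⊆Φ⁺ k l k,l∈A , k,l∈A , inj₁ (k≤i , j≤l)))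
    ... | inj₁ i,j∈A | inj₂ (_ , _ , ¬hc) = ⊥-elim (¬hc (i , j , A⊆Φ⁺ i j i,j∈A , i,j∈A , inj₂ (k≤i , j≤l)))
    ... | inj₂ (_ , refl , _) | inj₂ (_ , refl , _) with comparable-sameRank⇒≡ {k} {i} {r} (inj₁ (k≤i , j≤l))
    ... | refl = refl , refl

  R : ℕ
  R = maxRank n

  rankToggleStep : Sub → ℕ → Sub
  rankToggleStep B r = rankToggle n r B

  segmentStep : Sub → ℕ → Sub
  segmentStep B h = segment n h B

  segment-antichain : ∀ h A → IsAntichain n A → IsAntichain n (segment n h A)
  segment-antichain h = foldl-preserves (IsAntichain n) rankToggleStep (λ B r → rankToggle-antichain r B) (map (h +_) (upTo (suc R ∸ h)))


  segment-unfold : ∀ h A → segment n h A ≡ foldl rankToggleStep A (iterate suc h (suc R ∸ h))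
  segment-unfold h A = cong (foldl rankToggleStep A) (map-+-upTo h (suc R ∸ h))

  Rvac-unfold : ∀ A → Rvac n A ≡ foldl segmentStep A (iterate suc 0 (suc R))
  Rvac-unfold A = cong (foldl segmentStep A) (applyUpTo-iterate id 0 (suc R) (λ _ → refl))

  rankToggles-belowRank : ∀ c a A k l → l ≤ k + a → foldl rankToggleStep A (iterate suc a c) k l ≡ A k l
  rankToggles-belowRank zero a A k l _ = refl
  rankToggles-belowRank (suc c) a A k l l≤k+a =
    trans (rankToggles-belowRank c (suc a) (rankToggleStep A a) k l (≤-trans l≤k+a (+-monoʳ-≤ k (n≤1+n a))))
          (rankToggle-offRank a A k l λ { refl _ → <-irrefl refl (subst (_≤ k + a) (+-comm (k + a) 1) l≤k+a) })

  segment-belowRank : ∀ h A k l → l ≤ k + h → segment n h A k l ≡ A k l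
  segment-belowRank h A k l l≤k+h =
    trans (cong (λ B → B k l) (segment-unfold h A)) (rankToggles-belowRank (suc R ∸ h) h A k l l≤k+h)

  segments-belowRank : ∀ c a A k l → l ≤ k + a → foldl segmentStep A (iterate suc a c) k l ≡ A k l
  segments-belowRank zero a A k l _ = refl
  segments-belowRank (suc c) a A k l l≤k+a =
    trans (segments-belowRank c (suc a) (segmentStep A a) k l (≤-trans l≤k+a (+-monoʳ-≤ k (n≤1+n a))))
          (segment-belowRank a A k l l≤k+a)

  ∃Φ⁺? : (P : ℕ → ℕ → Set) → (∀ c d → Dec (P c d)) → (∀ {c d} → P c d → Φ⁺ c d) →
         Dec (Σ ℕ λ c → Σ ℕ λ d → P c d)
  ∃Φ⁺? P P? P⇒Φ⁺ with anyUpTo? (λ c → anyUpTo? (P? c) (suc (2 * n))) (suc (2 * n))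
  ... | yes (c , _ , d , _ , p) = yes (c , d , p)
  ... | no none = no λ (c , d , p) →
    none (c , s≤s (proj₁ (Φ⁺-bounded (P⇒Φ⁺ p))) , d , s≤s (proj₂ (Φ⁺-bounded (P⇒Φ⁺ p))) , p)

  Down : Sub → ℕ → ℕ → Set
  Down S i j = Σ ℕ λ c → Σ ℕ λ d → Φ⁺ c d × In S c d × Inside i j c d

  -- rank [c,d] = d - c - 1, so d ≤ c + h reads rank < h and c + h < d reads rank ≥ h
  Blocked : ℕ → Sub → ℕ → ℕ → Set
  Blocked h S i j = Σ ℕ λ c → Σ ℕ λ d → Φ⁺ c d × In S c d × d ≤ c + h × Inside c d i j

  Down? : ∀ S i j → Dec (Down S i j)
  Down? S i j = ∃Φ⁺? _ (λ c d → Φ⁺? c d ×-dec In? S c d ×-dec ((c ≤? i) ×-dec (j ≤? d))) proj₁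

  Down-antitone : ∀ {S i j c d} → Down S i j → Inside c d i j → Down S c d
  Down-antitone (a , b , valid , a,b∈S , i,j⊆a,b) c,d⊆i,j = a , b , valid , a,b∈S , Inside-trans c,d⊆i,j i,j⊆a,b

  Blocked-monotone : ∀ {h S c d i j} → Blocked h S c d → Inside c d i j → Blocked h S i j
  Blocked-monotone (a , b , valid , a,b∈S , rank , a,b⊆c,d) c,d⊆i,j =
    a , b , valid , a,b∈S , rank , Inside-trans a,b⊆c,d c,d⊆i,j

  Candidate : ℕ → Sub → ℕ → ℕ → Set
  Candidate h S i j = Φ⁺ i j × i + h < j × ¬ Blocked h S i j × ¬ Down S i j

  LowerCoversDown : ℕ → Sub → ℕ → ℕ → Set
  LowerCoversDown h S i j = ∀ j′ → j ≡ suc j′ → i + h < j′ → Down S (suc i) j × Down S i j′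

  -- The elements of rank ≥ h of segment h S (see segment-emerges below): the minimal elements
  -- of the unblocked part of rank ≥ h outside the down-set of S.
  Emerges : ℕ → Sub → ℕ → ℕ → Set
  Emerges h S i j = Candidate h S i j × LowerCoversDown h S i j

  candidate-rightCover : ∀ {h S c d} → Candidate h S c (suc d) → c + h < d → ¬ Down S (suc c) (suc d) →
                         Candidate h S (suc c) (suc d)
  candidate-rightCover {c = c} (valid , _ , ¬blocked , _) c+h<d ¬down =
    Φ⁺-rightCover valid (s≤s (≤-<-trans (m≤m+n c _) c+h<d)) , s≤s c+h<d ,
    (λ b → ¬blocked (Blocked-monotone b (n≤1+n c , ≤-refl))) , ¬down

  candidate-leftCover : ∀ {h S c d} → Candidate h S c (suc d) → c + h < d → ¬ Down S c d → Candidate h S c d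
  candidate-leftCover {c = c} {d} (valid , _ , ¬blocked , _) c+h<d ¬down =
    Φ⁺-leftCover valid (≤-<-trans (m≤m+n c _) c+h<d) , c+h<d ,
    (λ b → ¬blocked (Blocked-monotone b (≤-refl , n≤1+n d))) , ¬down

  -- Descend through lower covers outside the down-set until both lower covers are in it;
  -- m bounds the rank, so it measures the remaining descent.
  emerges-inside : ∀ {h S} m c d → d ≤ c + m → Candidate h S c d →
                   Σ ℕ λ c′ → Σ ℕ λ d′ → Inside c′ d′ c d × Emerges h S c′ d′
  emerges-inside m c zero _ ((_ , () , _) , _)
  emerges-inside {h} {S} m c (suc d) d<c+m cand with c + h <? d
  ... | no c+h≮d = c , suc d , Inside-refl , cand , λ { _ refl c+h<d → ⊥-elim (c+h≮d c+h<d) }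
  ... | yes c+h<d with Down? S (suc c) (suc d) | Down? S c d | m
  ... | yes right | yes left | _ = c , suc d , Inside-refl , cand , λ { _ refl _ → right , left }
  ... | _ | _ | zero = ⊥-elim (<-irrefl refl (<-≤-trans (proj₁ (proj₂ (proj₁ cand))) (subst (suc d ≤_) (+-identityʳ c) d<c+m)))
  ... | no ¬right | _ | suc m′
    with emerges-inside m′ (suc c) (suc d) (subst (suc d ≤_) (+-suc c m′) d<c+m) (candidate-rightCover cand c+h<d ¬right)
  ... | c′ , d′ , inside , emerges = c′ , d′ , Inside-trans inside (n≤1+n c , ≤-refl) , emerges
  emerges-inside {h} {S} m c (suc d) d<c+m cand | yes c+h<d | yes _ | no ¬left | suc m′
    with emerges-inside m′ c d (s≤s⁻¹ (subst (suc d ≤_) (+-suc c m′) d<c+m)) (candidate-leftCover cand c+h<d ¬left)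
  ... | c′ , d′ , inside , emerges = c′ , d′ , Inside-trans inside (≤-refl , n≤1+n d) , emerges

  candidate⇒emergesInside : ∀ {h S c d} → Candidate h S c d →
                            Σ ℕ λ c′ → Σ ℕ λ d′ → Inside c′ d′ c d × Emerges h S c′ d′
  candidate⇒emergesInside {c = c} {d} = emerges-inside d c d (m≤n+m d c)

  -- State after toggling ranks h, …, a - 1 of S
  record SegmentInvariant (h : ℕ) (S : Sub) (a : ℕ) (T : Sub) : Set where
    field
      belowRank : ∀ {k l} → Φ⁺ k l → l ≤ k + h → T k l ≡ S k l
      emerged   : ∀ {k l} → Φ⁺ k l → k + h < l → l ≤ k + a → In T k l → Emerges h S k l
      emerges   : ∀ {k l} → Emerges h S k l → l ≤ k + a → In T k l
      aboveRank : ∀ {k l} → Φ⁺ k l → k + a < l → T k l ≡ S k l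

  module _ {h S a T} (inv : SegmentInvariant h S a T) where
    open SegmentInvariant inv

    private
      insideIncomparable⇒Down : ∀ {k l c d} → ¬ HasComparable T k l → ¬ Blocked h S k l →
                              Φ⁺ c d → Inside c d k l → c + h < d → d ≤ c + a → Down S c d
      insideIncomparable⇒Down {c = c} {d} ¬comparable ¬blocked valid inside rank d≤c+a with Down? S c d
      ... | yes down = down
      ... | no ¬down with candidate⇒emergesInside (valid , rank , (λ b → ¬blocked (Blocked-monotone b inside)) , ¬down)
      ... | c′ , d′ , inside′@(c≤c′ , d′≤d) , em@((valid′ , _) , _) =
        ⊥-elim (¬comparable (c′ , d′ , valid′ , emerges em (≤-trans d′≤d (≤-trans d≤c+a (+-monoˡ-≤ a c≤c′))) ,
                             inj₂ (Inside-trans inside′ inside)))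

    toggled-emerges : ∀ {k} → h ≤ a → Φ⁺ k (suc (k + a)) → ¬ HasComparable T k (suc (k + a)) →
                      Emerges h S k (suc (k + a))
    toggled-emerges {k} h≤a valid ¬comparable =
      (valid , s≤s (+-monoʳ-≤ k h≤a) , ¬blocked , ¬down) , lowerCovers
      where
      ¬blocked : ¬ Blocked h S k (suc (k + a))
      ¬blocked (c , d , v , c,d∈S , rank , inside) =
        ¬comparable (c , d , v , trans (belowRank v rank) c,d∈S , inj₂ inside)
      ¬down : ¬ Down S k (suc (k + a))
      ¬down (c , d , v , c,d∈S , (c≤k , l≤d)) =
        ¬comparable (c , d , v , trans (aboveRank v (≤-trans (s≤s (+-monoˡ-≤ a c≤k)) l≤d)) c,d∈S , inj₁ (c≤k , l≤d))
      lowerCovers : LowerCoversDown h S k (suc (k + a))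
      lowerCovers _ refl k+h<k+a =
        insideIncomparable⇒Down ¬comparable ¬blocked
          (Φ⁺-rightCover valid (s≤s (≤-<-trans (m≤m+n k h) k+h<k+a))) (n≤1+n k , ≤-refl) (s≤s k+h<k+a) ≤-refl ,
        insideIncomparable⇒Down ¬comparable ¬blocked
          (Φ⁺-leftCover valid (≤-<-trans (m≤m+n k h) k+h<k+a)) (≤-refl , n≤1+n _) k+h<k+a ≤-refl

    emerges-toggled : ∀ {k} → Emerges h S k (suc (k + a)) →
                      T k (suc (k + a)) ≡ false × ¬ HasComparable T k (suc (k + a))
    emerges-toggled {k} ((valid , rank , ¬blocked , ¬down) , lowerCovers) = k,l∉T , ¬comparable
      where
      l = suc (k + a)
      k,l∉T : T k l ≡ false
      k,l∉T = trans (aboveRank valid ≤-refl) (¬true⇒false λ k,l∈S → ¬down (k , l , valid , k,l∈S , Inside-refl))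
      ¬comparable : ¬ HasComparable T k l
      ¬comparable (c , d , v , c,d∈T , inj₁ (c≤k , l≤d)) =
        ¬down (c , d , v , trans (sym (aboveRank v (≤-trans (s≤s (+-monoˡ-≤ a c≤k)) l≤d))) c,d∈T , (c≤k , l≤d))
      ¬comparable (c , d , v , c,d∈T , inj₂ (k≤c , d≤l)) with d ≤? c + h | d ≤? c + a
      ... | yes d≤c+h | _ =
        ¬blocked (c , d , v , trans (sym (belowRank v d≤c+h)) c,d∈T , d≤c+h , (k≤c , d≤l))
      ... | no d≰c+h | yes d≤c+a = ¬downInCover (emerged v (≰⇒> d≰c+h) d≤c+a c,d∈T)
        where
        ¬downInCover : Emerges h S c d → ⊥
        ¬downInCover ((_ , c+h<d , _ , ¬down′) , _) with m≤n⇒m<n∨m≡n k≤c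
        ... | inj₁ k<c = ¬down′ (Down-antitone (proj₁ (lowerCovers (k + a) refl k+h<k+a)) (k<c , d≤l))
          where
          k+h<k+a : k + h < k + a
          k+h<k+a = s≤s⁻¹ (≤-trans (s≤s (+-monoˡ-≤ h k<c)) (≤-trans c+h<d d≤l))
        ... | inj₂ refl = ¬down′ (Down-antitone (proj₂ (lowerCovers (k + a) refl (<-≤-trans c+h<d d≤c+a))) (≤-refl , d≤c+a))
      ... | no _ | no d≰c+a = true≢false (subst₂ (In T) c≡k d≡l c,d∈T) k,l∉T
        where
        c≡k : c ≡ k
        c≡k = ≤-antisym (+-cancelʳ-≤ a c k (s≤s⁻¹ (≤-trans (≰⇒> d≰c+a) d≤l))) k≤c
        d≡l : d ≡ l
        d≡l = ≤-antisym d≤l (subst (λ x → suc (x + a) ≤ d) c≡k (≰⇒> d≰c+a))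

  segmentInvariant-step : ∀ {h S a T} → h ≤ a → SegmentInvariant h S a T →
                          SegmentInvariant h S (suc a) (rankToggle n a T)
  segmentInvariant-step {h} {S} {a} {T} h≤a inv = record
    { belowRank = λ {k} {l} v l≤k+h →
        trans (offRank k l λ { refl → <-irrefl refl (≤-trans l≤k+h (+-monoʳ-≤ k h≤a)) })
              (belowRank v l≤k+h)
    ; emerged = emerged′
    ; emerges = emerges′
    ; aboveRank = λ {k} {l} v k+1+a<l →
        trans (offRank k l λ { refl → <-irrefl refl (subst (_< suc (k + a)) (+-suc k a) k+1+a<l) })
              (aboveRank v (≤-trans (s≤s (+-monoʳ-≤ k (n≤1+n a))) k+1+a<l))
    }
    where
    open SegmentInvariant inv

    offRank : ∀ k l → (l ≡ suc (k + a) → ⊥) → rankToggle n a T k l ≡ T k l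
    offRank k l l≢ = rankToggle-offRank a T k l (λ l≡ _ → l≢ (trans l≡ (+-comm (k + a) 1)))

    onRank : ∀ {k} → Φ⁺ k (suc (k + a)) →
             rankToggle n a T k (suc (k + a)) ≡ not (T k (suc (k + a))) ∧ not (hasComparable n T k (suc (k + a)))
    onRank {k} v = rankToggle-onRank a T k _ v (+-comm 1 (k + a))

    belowCurrentRank : ∀ {k l} → l ≤ k + suc a → (l ≡ suc (k + a) → ⊥) → l ≤ k + a
    belowCurrentRank {k} {l} l≤ l≢ = s≤s⁻¹ (≤∧≢⇒< (subst (l ≤_) (+-suc k a) l≤) l≢)

    emerged′ : ∀ {k l} → Φ⁺ k l → k + h < l → l ≤ k + suc a → In (rankToggle n a T) k l → Emerges h S k l
    emerged′ {k} {l} v rank l≤ e with l ≟ suc (k + a)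
    ... | yes refl = toggled-emerges inv h≤a v λ hc →
                       true≢false (HasComparable⇒hasComparable T k l hc) (proj₂ (not∧not-true⁻ (trans (sym (onRank v)) e)))
    ... | no l≢ = emerged v rank (belowCurrentRank l≤ l≢) (trans (sym (offRank k l l≢)) e)

    emerges′ : ∀ {k l} → Emerges h S k l → l ≤ k + suc a → In (rankToggle n a T) k l
    emerges′ {k} {l} em l≤ with l ≟ suc (k + a)
    ... | yes refl = let k,l∉T , ¬comparable = emerges-toggled inv em in
                     trans (onRank (proj₁ (proj₁ em)))
                           (not∧not-true⁺ k,l∉T (¬HasComparable⇒hasComparable≡false T k l ¬comparable))
    ... | no l≢ = trans (offRank k l l≢) (emerges em (belowCurrentRank l≤ l≢))

  segmentInvariant-start : ∀ h S → SegmentInvariant h S h S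
  segmentInvariant-start h S = record
    { belowRank = λ _ _ → refl
    ; emerged = λ _ rank l≤ _ → ⊥-elim (<-irrefl refl (<-≤-trans rank l≤))
    ; emerges = λ em l≤ → ⊥-elim (<-irrefl refl (<-≤-trans (proj₁ (proj₂ (proj₁ em))) l≤))
    ; aboveRank = λ _ _ → refl
    }

  segmentInvariant-rankToggles : ∀ c {h S a T} → h ≤ a → SegmentInvariant h S a T →
                                 SegmentInvariant h S (a + c) (foldl rankToggleStep T (iterate suc a c))
  segmentInvariant-rankToggles zero {h} {S} {a} {T} _ inv =
    subst (λ x → SegmentInvariant h S x T) (sym (+-identityʳ a)) inv
  segmentInvariant-rankToggles (suc c) {h} {S} {a} {T} h≤a inv =
    subst (λ x → SegmentInvariant h S x (foldl rankToggleStep T (iterate suc a (suc c)))) (sym (+-suc a c))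
      (segmentInvariant-rankToggles c (≤-trans h≤a (n≤1+n a)) (segmentInvariant-step h≤a inv))

  Φ⁺-rank≤R : ∀ {k l} → Φ⁺ k l → l ≤ k + suc R
  Φ⁺-rank≤R {k} (1≤k , _ , l≤2n) = ≤-trans l≤2n (≤-trans (m≤n+m∸n (2 * n) 2) (+-monoˡ-≤ (suc R) 1≤k))

  segment-invariant : ∀ h S → h ≤ suc R → SegmentInvariant h S (suc R) (segment n h S)
  segment-invariant h S h≤1+R =
    subst₂ (SegmentInvariant h S) (m+[n∸m]≡n h≤1+R) (sym (segment-unfold h S))
      (segmentInvariant-rankToggles (suc R ∸ h) ≤-refl (segmentInvariant-start h S))

  segment-emerged : ∀ {h S k l} → h ≤ suc R → Φ⁺ k l → k + h < l → In (segment n h S) k l → Emerges h S k l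
  segment-emerged {h} {S} h≤1+R v rank =
    SegmentInvariant.emerged (segment-invariant h S h≤1+R) v rank (Φ⁺-rank≤R v)

  segment-emerges : ∀ {h S k l} → h ≤ suc R → Emerges h S k l → In (segment n h S) k l
  segment-emerges {h} {S} h≤1+R em =
    SegmentInvariant.emerges (segment-invariant h S h≤1+R) em (Φ⁺-rank≤R (proj₁ (proj₁ em)))

  Blocked-segment : ∀ {h S c d} → Blocked h S c d → Blocked (suc h) (segment n h S) c d
  Blocked-segment {h} {S} (a , b , v , a,b∈S , b≤a+h , inside) =
    a , b , v , trans (segment-belowRank h S a b b≤a+h) a,b∈S , ≤-trans b≤a+h (+-monoʳ-≤ a (n≤1+n h)) , inside

  MeetsRow : Sub → ℕ → ℕ → Set
  MeetsRow A x e = Σ ℕ λ y → Φ⁺ x y × In A x y × e ≤ y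

  MeetsColumn : Sub → ℕ → ℕ → Set
  MeetsColumn A x e = Σ ℕ λ w → Φ⁺ w e × In A w e × w ≤ x

  ColumnFree : ℕ → Sub → ℕ → ℕ → Set
  ColumnFree h S x e = Φ⁺ x e × ¬ Blocked h S x e × ¬ MeetsColumn S x e

  RowColumnDuality : ℕ → Sub → Sub → Set
  RowColumnDuality h S out = ∀ x e → e ≡ suc (x + h) → MeetsRow out x e ⇔ ColumnFree h S x e

  notInSegment-rankH⇒Down : ∀ {h S i} → h ≤ suc R → Φ⁺ i (suc (i + h)) → ¬ Blocked h S i (suc (i + h)) →
                            ¬ In (segment n h S) i (suc (i + h)) → Down S i (suc (i + h))
  notInSegment-rankH⇒Down {h} {S} {i} h≤1+R valid ¬blocked ∉segment with Down? S i (suc (i + h))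
  ... | yes down = down
  ... | no ¬down = ⊥-elim (∉segment (segment-emerges h≤1+R
        ((valid , ≤-refl , ¬blocked , ¬down) , λ { _ refl i+h<i+h → ⊥-elim (<-irrefl refl i+h<i+h) })))

  ∈antichain⇒¬Down-extension : ∀ {S w e} → IsAntichain n S → In S w e → ¬ Down S w (suc e)
  ∈antichain⇒¬Down-extension {w = w} {e} (_ , S-antichain) w,e∈S (c , d , _ , c,d∈S , (c≤w , e+1≤d))
    with S-antichain w e c d w,e∈S c,d∈S c≤w (≤-trans (n≤1+n e) e+1≤d)
  ... | _ , refl = 1+n≰n e+1≤d

  -- [x+1,e+1] has rank h, so it lies below some [a,b] ∈ S; walking left from [x+1,e+1] to [w,e+1]
  -- one leaves the down-set of S at some [v,e+1], which then emerges at rank ≥ h.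
  columnFree-descends : ∀ {h S x} → h ≤ suc R → IsAntichain n S →
                        ColumnFree (suc h) (segment n h S) x (suc (suc (x + h))) → ¬ MeetsColumn S x (suc (x + h))
  columnFree-descends {h} {S} {x} h≤1+R antichain@(_ , S-antichain) (valid′ , ¬blocked′ , ¬column′) (w , vw , w,e∈S , w≤x)
    with x+1,e+1-valid ← Φ⁺-rightCover valid′ (s≤s (s≤s (m≤m+n x h)))
    with notInSegment-rankH⇒Down h≤1+R x+1,e+1-valid
           (λ b → ¬blocked′ (Blocked-segment (Blocked-monotone b (n≤1+n x , ≤-refl))))
           (λ ∈segment → ¬blocked′ (suc x , _ , x+1,e+1-valid , ∈segment , s≤s (≤-reflexive (sym (+-suc x h))) , (n≤1+n x , ≤-refl)))
  ... | x+1,e+1-down@(a , b , _ , a,b∈S , (a≤x+1 , e+1≤b))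
    with crossing (λ v → Down? S v (suc (suc (x + h)))) w≤x (∈antichain⇒¬Down-extension antichain w,e∈S) x+1,e+1-down
  ... | v , w≤v , v≤x , ¬down-v , down-v+1 = ¬column′ (v , v-valid , segment-emerges h≤1+R v-emerges , v≤x)
    where
    e = suc (x + h)

    ¬w,e+1-blocked : ¬ Blocked h S w (suc e)
    ¬w,e+1-blocked (c , d , _ , c,d∈S , d≤c+h , (w≤c , d≤e+1)) with d ≤? e
    ... | yes d≤e with S-antichain c d w e c,d∈S w,e∈S w≤c d≤e
    ...   | refl , refl = 1+n≰n (≤-trans d≤c+h (+-monoˡ-≤ h w≤x))
    ¬w,e+1-blocked (c , d , _ , c,d∈S , d≤c+h , (w≤c , d≤e+1)) | no d≰e =
      <-irrefl (sym (proj₁ (S-antichain c d a b c,d∈S a,b∈S (<⇒≤ a<c) (subst (_≤ b) (sym d≡e+1) e+1≤b)))) a<c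
      where
      d≡e+1 : d ≡ suc e
      d≡e+1 = ≤-antisym d≤e+1 (≰⇒> d≰e)
      a<c : a < c
      a<c = <-≤-trans (s≤s a≤x+1) (+-cancelʳ-≤ h (suc (suc x)) c (subst (_≤ c + h) d≡e+1 d≤c+h))

    v-valid : Φ⁺ v (suc e)
    v-valid = ≤-trans (proj₁ vw) w≤v , s≤s (≤-trans v≤x (≤-trans (m≤m+n x h) (n≤1+n _))) , proj₂ (proj₂ valid′)

    v-emerges : Emerges h S v (suc e)
    v-emerges =
      (v-valid , m<n⇒m<1+n (s≤s (+-monoˡ-≤ h v≤x)) , (λ b → ¬w,e+1-blocked (Blocked-monotone b (w≤v , ≤-refl))) , ¬down-v) ,
      λ { _ refl _ → down-v+1 , (w , e , vw , w,e∈S , (w≤v , ≤-refl)) }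

  columnFree-ascends : ∀ {h S x w y} → h ≤ suc R → IsAntichain n S → ColumnFree h S x (suc (x + h)) →
                       Φ⁺ w y → In S w y → w ≤ x → suc (suc (x + h)) ≤ y →
                       ColumnFree (suc h) (segment n h S) x (suc (suc (x + h)))
  columnFree-ascends {h} {S} {x} {w} {y} h≤1+R (_ , S-antichain) (valid , _ , ¬column) vwy w,y∈S w≤x e+1≤y =
    (proj₁ valid , s≤s (≤-trans (m≤m+n x h) (n≤1+n _)) , ≤-trans e+1≤y (proj₂ (proj₂ vwy))) , ¬blocked′ , ¬column′
    where
    e = suc (x + h)

    ¬blocked′ : ¬ Blocked (suc h) (segment n h S) x (suc e)
    ¬blocked′ (c , d , vcd , c,d∈S′ , _ , (x≤c , d≤e+1)) with d ≤? c + h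
    ... | yes d≤c+h with S-antichain c d w y (trans (sym (segment-belowRank h S c d d≤c+h)) c,d∈S′) w,y∈S
                           (≤-trans w≤x x≤c) (≤-trans d≤e+1 e+1≤y)
    ...   | refl , refl = 1+n≰n (≤-trans (n≤1+n _) (≤-trans e+1≤y (≤-trans d≤c+h (+-monoˡ-≤ h w≤x))))
    ¬blocked′ (c , d , vcd , c,d∈S′ , _ , (x≤c , d≤e+1)) | no d≰c+h =
      proj₂ (proj₂ (proj₂ (proj₁ (segment-emerged h≤1+R vcd (≰⇒> d≰c+h) c,d∈S′))))
        (w , y , vwy , w,y∈S , (≤-trans w≤x x≤c , ≤-trans d≤e+1 e+1≤y))

    ¬column′ : ¬ MeetsColumn (segment n h S) x (suc e)
    ¬column′ (u , vu , u,e+1∈S′ , u≤x) with segment-emerged h≤1+R vu (s≤s (≤-trans (+-monoˡ-≤ h u≤x) (n≤1+n _))) u,e+1∈S′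
    ... | ((_ , _ , _ , ¬down) , lowerCovers) with proj₂ (lowerCovers e refl (s≤s (+-monoˡ-≤ h u≤x)))
    ... | a , b , vab , a,b∈S , (a≤u , e≤b) with m≤n⇒m<n∨m≡n e≤b
    ...   | inj₂ refl = ¬column (a , vab , a,b∈S , ≤-trans a≤u u≤x)
    ...   | inj₁ e<b = ¬down (a , b , vab , a,b∈S , (a≤u , e<b))

  rowColumnDuality-step : ∀ {h S out} → h ≤ suc R → IsAntichain n S →
                          (∀ x y → y ≤ x + suc h → out x y ≡ segment n h S x y) →
                          RowColumnDuality (suc h) (segment n h S) out → RowColumnDuality h S out
  rowColumnDuality-step {h} {S} {out} h≤1+R antichain out≡S′ IH x _ refl = mk⇔ row⇒columnFree columnFree⇒row
    where
    e = suc (x + h)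
    open Equivalence (IH x (suc e) (cong suc (sym (+-suc x h)))) renaming (to to IH-to; from to IH-from)

    x,e∈out⇔S′ : out x e ≡ segment n h S x e
    x,e∈out⇔S′ = out≡S′ x e (≤-reflexive (sym (+-suc x h)))

    row⇒columnFree : MeetsRow out x e → ColumnFree h S x e
    row⇒columnFree (y , valid , x,y∈out , e≤y) with m≤n⇒m<n∨m≡n e≤y
    ... | inj₂ refl with segment-emerged h≤1+R valid ≤-refl (trans (sym x,e∈out⇔S′) x,y∈out)
    ...   | (_ , _ , ¬blocked , ¬down) , _ =
      valid , ¬blocked , λ (w , vw , w,e∈S , w≤x) → ¬down (w , e , vw , w,e∈S , (w≤x , ≤-refl))
    row⇒columnFree (y , valid , x,y∈out , e≤y) | inj₁ e<y with IH-to (y , valid , x,y∈out , e<y)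
    ... | columnFree′@((1≤x , _ , e+1≤2n) , ¬blocked′ , _) =
      (1≤x , s≤s (m≤m+n x h) , ≤-trans (n≤1+n e) e+1≤2n) ,
      (λ b → ¬blocked′ (Blocked-segment (Blocked-monotone b (≤-refl , n≤1+n e)))) ,
      columnFree-descends h≤1+R antichain columnFree′

    columnFree⇒row : ColumnFree h S x e → MeetsRow out x e
    columnFree⇒row columnFree@(valid , ¬blocked , ¬column) with Down? S x e
    ... | no ¬down =
      e , valid ,
      trans x,e∈out⇔S′ (segment-emerges h≤1+R ((valid , ≤-refl , ¬blocked , ¬down) , λ { _ refl e<e → ⊥-elim (<-irrefl refl e<e) })) ,
      ≤-refl
    ... | yes (w , y , vwy , w,y∈S , (w≤x , e≤y)) with m≤n⇒m<n∨m≡n e≤y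
    ...   | inj₂ refl = ⊥-elim (¬column (w , vwy , w,y∈S , w≤x))
    ...   | inj₁ e<y with IH-from (columnFree-ascends h≤1+R antichain columnFree vwy w,y∈S w≤x e<y)
    ...     | y′ , valid′ , x,y′∈out , e+1≤y′ = y′ , valid′ , x,y′∈out , ≤-trans (n≤1+n e) e+1≤y′

  rowColumnDuality-top : ∀ S out → RowColumnDuality (suc R) S out
  rowColumnDuality-top S out x _ refl =
    mk⇔ (λ (_ , valid , _ , e≤y) → ⊥-elim (1+n≰n (≤-trans e≤y (Φ⁺-rank≤R valid))))
        (λ (valid , _) → ⊥-elim (1+n≰n (Φ⁺-rank≤R valid)))

  rowColumnDuality-segments : ∀ c h S → h + c ≡ suc R → IsAntichain n S →
                              RowColumnDuality h S (foldl segmentStep S (iterate suc h c))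
  rowColumnDuality-segments zero h S h+0≡1+R _ =
    subst (λ h → RowColumnDuality h S S) (sym (trans (sym (+-identityʳ h)) h+0≡1+R)) (rowColumnDuality-top S S)
  rowColumnDuality-segments (suc c) h S h+1+c≡1+R antichain =
    rowColumnDuality-step (subst (h ≤_) h+1+c≡1+R (m≤m+n h (suc c))) antichain
      (λ x y → segments-belowRank c (suc h) (segment n h S) x y)
      (rowColumnDuality-segments c (suc h) (segment n h S) (trans (sym (+-suc h c)) h+1+c≡1+R)
        (segment-antichain h S antichain))

  rowColumnDuality-Rvac : ∀ S → IsAntichain n S → RowColumnDuality 0 S (Rvac n S)
  rowColumnDuality-Rvac S antichain =
    subst (RowColumnDuality 0 S) (sym (Rvac-unfold S)) (rowColumnDuality-segments (suc R) 0 S refl antichain)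

  2n+1 : ℕ
  2n+1 = 2 * n + 1

  Mirror : Sub → Sub → Set
  Mirror A′ A = ∀ k l → A′ k l ≡ A (2n+1 ∸ l) (2n+1 ∸ k)

  2n<2n+1 : 2 * n < 2n+1
  2n<2n+1 = subst (2 * n <_) (+-comm 1 (2 * n)) ≤-refl

  Φ⁺-ends≤2n+1 : ∀ {k l} → Φ⁺ k l → k ≤ 2n+1 × l ≤ 2n+1
  Φ⁺-ends≤2n+1 valid = let k≤2n , l≤2n = Φ⁺-bounded valid in ≤-trans k≤2n (<⇒≤ 2n<2n+1) , ≤-trans l≤2n (<⇒≤ 2n<2n+1)

  η-Φ⁺ : ∀ {k l} → Φ⁺ k l → Φ⁺ (2n+1 ∸ l) (2n+1 ∸ k)
  η-Φ⁺ {k} valid@(1≤k , k<l , l≤2n) =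
    m<n⇒0<n∸m (≤-<-trans l≤2n 2n<2n+1) ,
    ∸-monoʳ-< k<l (proj₂ (Φ⁺-ends≤2n+1 valid)) ,
    subst (2n+1 ∸ k ≤_) (m+n∸n≡m (2 * n) 1) (∸-monoʳ-≤ 2n+1 1≤k)

  η-Φ⁺⁻ : ∀ {k l} → Φ⁺ (2n+1 ∸ l) (2n+1 ∸ k) → Φ⁺ k l
  η-Φ⁺⁻ {k} {l} valid = subst₂ Φ⁺ (m∸[m∸n]≡n k≤2n+1) (m∸[m∸n]≡n l≤2n+1) (η-Φ⁺ valid)
    where
    0<2n+1∸l : 0 < 2n+1 ∸ l
    0<2n+1∸l = proj₁ valid
    l≤2n+1 : l ≤ 2n+1
    l≤2n+1 = <⇒≤ (m∸n≢0⇒n<m (<⇒≢ 0<2n+1∸l ∘ sym))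
    k≤2n+1 : k ≤ 2n+1
    k≤2n+1 = <⇒≤ (m∸n≢0⇒n<m (<⇒≢ (≤-trans 0<2n+1∸l (<⇒≤ (proj₁ (proj₂ valid)))) ∘ sym))

  η-Comparable : ∀ {i j k l} → Comparable i j k l → Comparable (2n+1 ∸ j) (2n+1 ∸ i) (2n+1 ∸ l) (2n+1 ∸ k)
  η-Comparable (inj₁ (k≤i , j≤l)) = inj₁ (∸-monoʳ-≤ 2n+1 j≤l , ∸-monoʳ-≤ 2n+1 k≤i)
  η-Comparable (inj₂ (i≤k , l≤j)) = inj₂ (∸-monoʳ-≤ 2n+1 l≤j , ∸-monoʳ-≤ 2n+1 i≤k)

  η-rank : ∀ {k l r} → l ≡ k + r + 1 → l ≤ 2n+1 → 2n+1 ∸ k ≡ (2n+1 ∸ l) + r + 1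
  η-rank {k} {l} {r} refl l≤2n+1 = begin
    2n+1 ∸ k                 ≡⟨ cong (_∸ k) (m∸n+n≡m l≤2n+1) ⟨
    (2n+1 ∸ l) + l ∸ k       ≡⟨ +-∸-assoc (2n+1 ∸ l) (≤-trans (m≤m+n k r) (m≤m+n (k + r) 1)) ⟩
    (2n+1 ∸ l) + (l ∸ k)     ≡⟨ cong ((2n+1 ∸ l) +_) (trans (cong (_∸ k) (+-assoc k r 1)) (m+n∸m≡n k (r + 1))) ⟩
    (2n+1 ∸ l) + (r + 1)     ≡⟨ +-assoc (2n+1 ∸ l) r 1 ⟨
    (2n+1 ∸ l) + r + 1       ∎
    where open ≡-Reasoning

  η-rank⁻ : ∀ {k l r} → Φ⁺ (2n+1 ∸ l) (2n+1 ∸ k) → 2n+1 ∸ k ≡ (2n+1 ∸ l) + r + 1 → l ≡ k + r + 1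
  η-rank⁻ {k} {l} {r} valid rank =
    subst₂ (λ a b → a ≡ b + r + 1) (m∸[m∸n]≡n l≤2n+1) (m∸[m∸n]≡n k≤2n+1) (η-rank rank (proj₂ (Φ⁺-ends≤2n+1 valid)))
    where
    k≤2n+1 : k ≤ 2n+1
    k≤2n+1 = proj₁ (Φ⁺-ends≤2n+1 (η-Φ⁺⁻ {k} {l} valid))
    l≤2n+1 : l ≤ 2n+1
    l≤2n+1 = proj₂ (Φ⁺-ends≤2n+1 (η-Φ⁺⁻ {k} {l} valid))

  hasComparable-mirror : ∀ {A′ A} → Mirror A′ A → ∀ {k l} → Φ⁺ k l →
                         hasComparable n A′ k l ≡ hasComparable n A (2n+1 ∸ l) (2n+1 ∸ k)
  hasComparable-mirror {A′} {A} mirror {k} {l} valid = true-ext to from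
    where
    to : hasComparable n A′ k l ≡ true → hasComparable n A (2n+1 ∸ l) (2n+1 ∸ k) ≡ true
    to e with hasComparable⇒HasComparable A′ k l e
    ... | c , d , v , c,d∈A′ , cmp =
      HasComparable⇒hasComparable A _ _ (2n+1 ∸ d , 2n+1 ∸ c , η-Φ⁺ v , trans (sym (mirror c d)) c,d∈A′ , η-Comparable cmp)
    from : hasComparable n A (2n+1 ∸ l) (2n+1 ∸ k) ≡ true → hasComparable n A′ k l ≡ true
    from e with hasComparable⇒HasComparable A _ _ e
    ... | c , d , v , c,d∈A , cmp =
      HasComparable⇒hasComparable A′ k l
        (2n+1 ∸ d , 2n+1 ∸ c , η-Φ⁺ v ,
         trans (mirror _ _) (subst₂ (In A) (sym (m∸[m∸n]≡n c≤2n+1)) (sym (m∸[m∸n]≡n d≤2n+1)) c,d∈A) ,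
         subst₂ (λ i j → Comparable i j _ _) (m∸[m∸n]≡n k≤2n+1) (m∸[m∸n]≡n l≤2n+1) (η-Comparable cmp))
      where
      c≤2n+1 = proj₁ (Φ⁺-ends≤2n+1 v)
      d≤2n+1 = proj₂ (Φ⁺-ends≤2n+1 v)
      k≤2n+1 = proj₁ (Φ⁺-ends≤2n+1 valid)
      l≤2n+1 = proj₂ (Φ⁺-ends≤2n+1 valid)

  rankToggle-mirror : ∀ r {A′ A} → Mirror A′ A → Mirror (rankToggle n r A′) (rankToggle n r A)
  rankToggle-mirror r {A′} {A} mirror k l with Φ⁺? k l | l ≟ k + r + 1
  ... | yes valid | yes l≡ =
    trans (rankToggle-onRank r A′ k l valid l≡)
      (trans (cong₂ (λ a b → not a ∧ not b) (mirror k l) (hasComparable-mirror mirror valid))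
        (sym (rankToggle-onRank r A _ _ (η-Φ⁺ valid) (η-rank l≡ (proj₂ (Φ⁺-ends≤2n+1 valid))))))
  ... | yes _ | no l≢ =
    trans (rankToggle-offRank r A′ k l (λ l≡ _ → l≢ l≡))
      (trans (mirror k l) (sym (rankToggle-offRank r A _ _ (λ l≡ v → l≢ (η-rank⁻ v l≡)))))
  ... | no invalid | _ =
    trans (rankToggle-offRank r A′ k l (λ _ v → invalid v))
      (trans (mirror k l) (sym (rankToggle-offRank r A _ _ (λ _ v → invalid (η-Φ⁺⁻ v)))))

  segment-mirror : ∀ h {A′ A} → Mirror A′ A → Mirror (segment n h A′) (segment n h A)
  segment-mirror h = foldl-preserves₂ Mirror rankToggleStep (λ _ _ r → rankToggle-mirror r) (map (h +_) (upTo (suc R ∸ h))) _ _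

  Rvac-mirror : ∀ {A′ A} → Mirror A′ A → Mirror (Rvac n A′) (Rvac n A)
  Rvac-mirror = foldl-preserves₂ Mirror segmentStep (λ _ _ h → segment-mirror h) (upTo (suc R)) _ _

  antichain-etaInvariant⇒Mirror : ∀ {B} → IsAntichain n B → EtaInvariant n B → Mirror B B
  antichain-etaInvariant⇒Mirror {B} (B⊆Φ⁺ , _) eta k l with Φ⁺? k l
  ... | yes valid = eta k l valid
  ... | no invalid = trans (¬true⇒false (invalid ∘ B⊆Φ⁺ k l)) (sym (¬true⇒false (invalid ∘ η-Φ⁺⁻ ∘ B⊆Φ⁺ _ _)))

  2n+1∸[1+n]≡n : 2n+1 ∸ suc n ≡ n
  2n+1∸[1+n]≡n = begin
    2 * n + 1 ∸ suc n   ≡⟨ cong (_∸ suc n) (+-comm (2 * n) 1) ⟩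
    suc (n + (n + 0)) ∸ suc n ≡⟨ cong (λ m → suc (n + m) ∸ suc n) (+-identityʳ n) ⟩
    n + n ∸ n           ≡⟨ m+n∸m≡n n n ⟩
    n                   ∎
    where open ≡-Reasoning

  2n+1∸n≡1+n : 2n+1 ∸ n ≡ suc n
  2n+1∸n≡1+n = begin
    2 * n + 1 ∸ n       ≡⟨ cong (_∸ n) (+-comm (2 * n) 1) ⟩
    suc (n + (n + 0)) ∸ n ≡⟨ cong (λ m → suc (n + m) ∸ n) (+-identityʳ n) ⟩
    suc (n + n) ∸ n     ≡⟨ cong (_∸ n) (+-comm (suc n) n) ⟩
    n + suc n ∸ n       ≡⟨ m+n∸m≡n n (suc n) ⟩
    suc n               ∎
    where open ≡-Reasoning

  MeetsS⇒MeetsRow : ∀ {A} → Mirror A A → MeetsS n A → MeetsRow A n (suc n)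
  MeetsS⇒MeetsRow _ (_ , j , valid , n,j∈A , inj₁ refl) = j , valid , n,j∈A , proj₁ (proj₂ valid)
  MeetsS⇒MeetsRow {A} mirror (i , _ , valid , i,n+1∈A , inj₂ refl) =
    2n+1 ∸ i , subst (λ k → Φ⁺ k (2n+1 ∸ i)) 2n+1∸[1+n]≡n (η-Φ⁺ valid) ,
    trans (sym (trans (mirror i (suc n)) (cong (λ k → A k (2n+1 ∸ i)) 2n+1∸[1+n]≡n))) i,n+1∈A ,
    subst (_< 2n+1 ∸ i) 2n+1∸[1+n]≡n (proj₁ (proj₂ (η-Φ⁺ valid)))

  MeetsS⇒MeetsColumn : ∀ {A} → Mirror A A → MeetsS n A → MeetsColumn A n (suc n)
  MeetsS⇒MeetsColumn _ (i , _ , valid , i,n+1∈A , inj₂ refl) = i , valid , i,n+1∈A , s≤s⁻¹ (proj₁ (proj₂ valid))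
  MeetsS⇒MeetsColumn {A} mirror (_ , j , valid , n,j∈A , inj₁ refl) =
    2n+1 ∸ j , subst (Φ⁺ _) 2n+1∸n≡1+n (η-Φ⁺ valid) ,
    trans (sym (trans (mirror n j) (cong (A (2n+1 ∸ j)) 2n+1∸n≡1+n))) n,j∈A ,
    s≤s⁻¹ (subst (2n+1 ∸ j <_) 2n+1∸n≡1+n (proj₁ (proj₂ (η-Φ⁺ valid))))

  MeetsRow⇒MeetsS : ∀ {A} → MeetsRow A n (suc n) → MeetsS n A
  MeetsRow⇒MeetsS (j , valid , n,j∈A , _) = n , j , valid , n,j∈A , inj₁ refl

  MeetsColumn⇒MeetsS : ∀ {A} → MeetsColumn A n (suc n) → MeetsS n A
  MeetsColumn⇒MeetsS (i , valid , i,n+1∈A , _) = i , suc n , valid , i,n+1∈A , inj₂ refl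

  MeetsColumn? : ∀ A x e → Dec (MeetsColumn A x e)
  MeetsColumn? A x e with anyUpTo? (λ w → Φ⁺? w e ×-dec In? A w e) (suc x)
  ... | yes (w , w<1+x , valid , w,e∈A) = yes (w , valid , w,e∈A , s≤s⁻¹ w<1+x)
  ... | no none = no λ (w , valid , w,e∈A , w≤x) → none (w , s≤s w≤x , valid , w,e∈A)

  ¬Blocked-rank0 : ∀ S i j → ¬ Blocked 0 S i j
  ¬Blocked-rank0 S i j (c , d , (_ , c<d , _) , _ , d≤c+0 , _) = <-irrefl refl (<-≤-trans c<d (subst (d ≤_) (+-identityʳ c) d≤c+0))

proposition6p3 : (n : ℕ) → 1 ≤ n → (B : Sub) → IsAntichain n B → EtaInvariant n B →
    (MeetsS n B × ¬ MeetsS n (Rvac n B)) ⊎ (¬ MeetsS n B × MeetsS n (Rvac n B))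
proposition6p3 n 1≤n B antichain eta = byColumn (MeetsColumn? B n (suc n))
  where
  open Poset n
  open Equivalence (rowColumnDuality-Rvac B antichain n (suc n) (cong suc (sym (+-identityʳ n))))

  B-mirror : Mirror B B
  B-mirror = antichain-etaInvariant⇒Mirror antichain eta

  n,n+1-valid : Φ⁺ n (suc n)
  n,n+1-valid = 1≤n , ≤-refl , subst (suc n ≤_) (cong (n +_) (sym (+-identityʳ n))) (+-monoˡ-≤ n 1≤n)

  byColumn : Dec (MeetsColumn B n (suc n)) → (MeetsS n B × ¬ MeetsS n (Rvac n B)) ⊎ (¬ MeetsS n B × MeetsS n (Rvac n B))
  byColumn (yes column) =
    inj₁ (MeetsColumn⇒MeetsS column , λ meets → proj₂ (proj₂ (to (MeetsS⇒MeetsRow (Rvac-mirror B-mirror) meets))) column)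
  byColumn (no ¬column) =
    inj₂ (¬column ∘ MeetsS⇒MeetsColumn B-mirror ,
          MeetsRow⇒MeetsS (from (n,n+1-valid , ¬Blocked-rank0 B n (suc n) , ¬column)))
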